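{- Let $G$ be any finite simple graph with harmonic operator $a$ on its state space $\mathcal{V}_G$, let $k\ge0$, $m\ge1$ be the smallest integers with $a^{k+m}=a^k$, and let $L(G)=\operatorname{Im} a^{mk}$. Then $\dim_{\mathbf{Z}_2} L(G)$ is even.
   Context: $G$ is a finite simple graph with vertices $v_1,\dots,v_n$. The state space $\mathcal{V}_G$ is the set of subsets of the vertex set, a $\mathbf{Z}_2$-vector space under symmetric difference, identified with $\mathbf{Z}_2^n$. The harmonic operator $a$ is the $\mathbf{Z}_2$-linear map on $\mathcal{V}_G$ with matrix $A+D\pmod 2$ in the vertex basis, $A$ the adjacency matrix and $D$ diagonal with $D_{ii}=1$ iff $v_i$ has odd degree. -}

module Defs where

open import Data.Bool using (Bool; true; false; if_then_else_; _xor_; _∧_)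
open import Data.Nat using (ℕ; zero; suc; _+_; _*_; _%_; _≡ᵇ_; _≤_)
open import Data.Fin using (Fin; _≟_)
open import Data.List using (List; map; allFin; foldr)
open import Data.Nat.ListAction using (sum)
open import Data.Vec.Functional using (Vector)
open import Data.Product using (Σ; _×_; ∃)
open import Relation.Nullary using (yes; no)
open import Relation.Binary.PropositionalEquality using (_≡_)

record SimpleGraph (n : ℕ) : Set where
  field
    adj   : Fin n → Fin n → Bool
    sym   : ∀ i j → adj i j ≡ adj j i
    loopless : ∀ i → adj i i ≡ false
open SimpleGraph public

-- State space V_G = Z_2^n, elements = subsets of the vertex set (characteristic vectors).
State : ℕ → Set
State n = Vector Bool n

⊕Σ : ∀ {n} → (Fin n → Bool) → Bool
⊕Σ {n} f = foldr (λ j b → f j xor b) false (allFin n)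

degree : ∀ {n} → SimpleGraph n → Fin n → ℕ
degree {n} G i = sum (map (λ j → if adj G i j then 1 else 0) (allFin n))

oddDeg : ∀ {n} → SimpleGraph n → Fin n → Bool
oddDeg G i = (degree G i % 2) ≡ᵇ 1

harmonicMatrix : ∀ {n} → SimpleGraph n → Fin n → Fin n → Bool
harmonicMatrix G i j with i ≟ j
... | yes _ = adj G i j xor oddDeg G i
... | no  _ = adj G i j

harmonic : ∀ {n} → SimpleGraph n → State n → State n
harmonic G v i = ⊕Σ (λ j → harmonicMatrix G i j ∧ v j)

iter : ∀ {A : Set} → ℕ → (A → A) → A → A
iter zero    f x = x
iter (suc k) f x = f (iter k f x)

_≗ₗ_ : ∀ {n} → (State n → State n) → (State n → State n) → Set
f ≗ₗ g = ∀ v i → f v i ≡ g v i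

InImage : ∀ {n} → (State n → State n) → State n → Set
InImage f v = ∃ λ w → ∀ i → f w i ≡ v i

linComb : ∀ {n d} → (Fin d → State n) → (Fin d → Bool) → State n
linComb b c i = ⊕Σ (λ t → c t ∧ b t i)

zeroVec : ∀ {n} → State n
zeroVec _ = false

record IsBasis {n d : ℕ} (P : State n → Set) (b : Fin d → State n) : Set where
  field
    inside      : ∀ t → P (b t)
    independent : ∀ c → (∀ i → linComb b c i ≡ false) → ∀ t → c t ≡ false
    spanning    : ∀ v → P v → ∃ λ c → ∀ i → linComb b c i ≡ v i

HasDim : ∀ {n} → (State n → Set) → ℕ → Set
HasDim {n} P d = Σ (Fin d → State n) (IsBasis P)

module Submission where

-- The harmonic operator a is symmetric and kills the all-ones vector 𝟙. Over Z₂ we have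
-- ⟨w, w⟩ = ⟨𝟙, w⟩, hence for N ≥ 1 the form ⟨u, a²ᴺ v⟩ = ⟨aᴺ u, aᴺ v⟩ is alternating, and it
-- induces a nondegenerate alternating form ω(a²ᴺ u, a²ᴺ v) = ⟨u, a²ᴺ v⟩ on Im a²ᴺ. Splitting off
-- hyperbolic pairs e, f with ω(e, f) = 1 shows that such a space has even dimension.
-- Finally a^{mk} = a²ᴺ for N = m(k + 1), because a^{k + tm} = aᵏ and mk ≥ k.

open import Defs renaming (sym to adj-sym)
open import Algebra.Bundles using (CommutativeRing)
open import Data.Bool using (Bool; true; false; _xor_; _∧_; not; if_then_else_)
open import Data.Bool.Properties
  using (xor-∧-commutativeRing; xor-same; xor-identityʳ; ∧-comm; ∧-assoc; ∧-idem; ∧-identityʳ; ∧-zeroʳ; ¬-not)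
  renaming (_≟_ to _≟ᵇ_)
open import Data.Fin using (Fin; zero; suc; punchIn; punchOut; _≟_)
open import Data.Fin.Properties using (any?; punchIn-punchOut; punchInᵢ≢i)
open import Data.List using (foldr; tabulate; allFin)
import Data.List as List
import Data.Nat.ListAction as ℕ
open import Data.Nat using (ℕ; zero; suc; _+_; _*_; _%_; _≡ᵇ_; _≤_)
import Data.Nat.Tactic.RingSolver as ℕ-Solver
open import Data.Nat.Divisibility using (_∣_; _∣0; ∣-refl; ∣m∣n⇒∣m+n)
open import Data.Product using (Σ; ∃; _,_; _×_; proj₁; proj₂)
open import Data.Vec.Functional using (_∷_; insertAt; removeAt)
open import Data.Vec.Functional.Properties using (insertAt-lookup; insertAt-punchIn)
open import Function using (_∘_; const)
open import Relation.Binary.PropositionalEquality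
open import Relation.Nullary using (yes; no; contradiction)
open import Tactic.RingSolver using (solve-∀)
open import Tactic.RingSolver.Core.AlmostCommutativeRing using (AlmostCommutativeRing; fromCommutativeRing)
open import Data.Maybe using (nothing)

open import Algebra.Properties.Semiring.Sum (CommutativeRing.semiring xor-∧-commutativeRing)
open ≡-Reasoning

-- Sums over Z₂

Z₂ : AlmostCommutativeRing _ _
Z₂ = fromCommutativeRing xor-∧-commutativeRing (λ _ → nothing)

foldr-xor-tabulate : ∀ {m n} (f : Fin m → Bool) (g : Fin n → Fin m) →
  foldr (λ j b → f j xor b) false (tabulate g) ≡ sum (f ∘ g)
foldr-xor-tabulate {n = zero}  f g = refl
foldr-xor-tabulate {n = suc n} f g = cong (f (g zero) xor_) (foldr-xor-tabulate f (g ∘ suc))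

⊕Σ≡sum : ∀ {n} (f : Fin n → Bool) → ⊕Σ f ≡ sum f
⊕Σ≡sum f = foldr-xor-tabulate f (λ i → i)

sum-insertAt : ∀ {n} (c : Fin n → Bool) i x (g : Fin (suc n) → Bool) →
  sum (λ t → insertAt c i x t ∧ g t) ≡ (x ∧ g i) xor sum (λ s → c s ∧ g (punchIn i s))
sum-insertAt c i x g = trans (sum-remove {i = i} (λ t → insertAt c i x t ∧ g t))
  (cong₂ _xor_ (cong (_∧ g i) (insertAt-lookup c i x))
               (sum-cong-≗ {x = λ s → insertAt c i x (punchIn i s) ∧ g (punchIn i s)}
                           (λ s → cong (_∧ g (punchIn i s)) (insertAt-punchIn c i x s))))

sum-update-at : ∀ {n} {f g : Fin n → Bool} i → (∀ j → i ≢ j → f j ≡ g j) → f i xor sum g ≡ g i xor sum f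
sum-update-at {suc n} {f} {g} i f≗g = begin
  f i xor sum g                              ≡⟨ cong (f i xor_) (sum-remove {i = i} g) ⟩
  f i xor (g i xor sum (removeAt g i))       ≡⟨ cong (λ r → f i xor (g i xor r)) (sum-cong-≗ {x = removeAt g i}
                                                  (λ j → sym (f≗g (punchIn i j) (punchInᵢ≢i i j ∘ sym)))) ⟩
  f i xor (g i xor sum (removeAt f i))       ≡⟨ swap (f i) (g i) (sum (removeAt f i)) ⟩
  g i xor (f i xor sum (removeAt f i))       ≡⟨ cong (g i xor_) (sum-remove {i = i} f) ⟨
  g i xor sum f                              ∎
  where
    swap : ∀ x y z → x xor (y xor z) ≡ y xor (x xor z)
    swap = solve-∀ Z₂

∑-distrib-xor₃ : ∀ {n} (f g h : Fin n → Bool) → sum (λ i → f i xor (g i xor h i)) ≡ sum f xor (sum g xor sum h)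
∑-distrib-xor₃ f g h = trans (∑-distrib-+ f (λ i → g i xor h i)) (cong (sum f xor_) (∑-distrib-+ g h))

sum-vanishing : ∀ {n} (f : Fin n → Bool) → (∀ i → f i ≡ false) → sum f ≡ false
sum-vanishing {n} f f≗0 = trans (sum-cong-≗ {x = f} {y = λ _ → false} f≗0) (sum-replicate-zero n)

-- Symplectic matrices have even size

Matrix : ℕ → Set
Matrix d = Fin d → Fin d → Bool

infixr 5 _*ᵥ_
_*ᵥ_ : ∀ {d} → Matrix d → (Fin d → Bool) → Fin d → Bool
(G *ᵥ c) s = sum (λ t → c t ∧ G s t)

record IsSymplectic {d} (G : Matrix d) : Set where
  field
    symmetric     : ∀ s t → G s t ≡ G t s
    alternating   : ∀ s → G s s ≡ false
    nondegenerate : ∀ c → (∀ s → (G *ᵥ c) s ≡ false) → ∀ t → c t ≡ false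

hyperbolic-partner : ∀ {d} {G : Matrix (suc d)} → IsSymplectic G → Σ (Fin d) λ j → G zero (suc j) ≡ true
hyperbolic-partner {d} {G} sp with any? (λ j → G zero (suc j) ≟ᵇ true)
... | yes found = found
... | no none = contradiction (nondegenerate e₀ e₀-in-kernel zero) λ ()
  where
    open IsSymplectic sp
    e₀ : Fin (suc d) → Bool
    e₀ = true ∷ const false
    first-row-zero : ∀ s → G zero s ≡ false
    first-row-zero zero    = alternating zero
    first-row-zero (suc s) = ¬-not (λ G0s → none (s , G0s))
    e₀-in-kernel : ∀ s → (G *ᵥ e₀) s ≡ false
    e₀-in-kernel s = cong₂ _xor_ (trans (symmetric s zero) (first-row-zero s)) (sum-replicate-zero d)

-- The form restricted to the orthogonal complement of the hyperbolic pair e₀, eⱼ (ω(e₀, eⱼ) = 1),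
-- in the basis of projections p x = x + ω(x, eⱼ) e₀ + ω(x, e₀) eⱼ of the remaining basis vectors.
module Reduction {d} {G : Matrix (suc (suc d))} (sp : IsSymplectic G)
                 (j : Fin (suc d)) (G0j : G zero (suc j) ≡ true) where
  open IsSymplectic sp

  ι : Fin d → Fin (suc (suc d))
  ι s = suc (punchIn j s)

  reduced : Matrix d
  reduced s t = G (ι s) (ι t) xor ((G (ι s) zero ∧ G (suc j) (ι t)) xor (G (ι s) (suc j) ∧ G zero (ι t)))

  reduced-symmetric : ∀ s t → reduced s t ≡ reduced t s
  reduced-symmetric s t = begin
    reduced s t
      ≡⟨ cong₂ _xor_ (symmetric _ _) (cong₂ _xor_ (cong₂ _∧_ (symmetric _ _) (symmetric _ _))
                                                   (cong₂ _∧_ (symmetric _ _) (symmetric _ _))) ⟩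
    G (ι t) (ι s) xor ((G zero (ι s) ∧ G (ι t) (suc j)) xor (G (suc j) (ι s) ∧ G (ι t) zero))
      ≡⟨ swap (G (ι t) (ι s)) (G zero (ι s)) (G (ι t) (suc j)) (G (suc j) (ι s)) (G (ι t) zero) ⟩
    reduced t s ∎
    where
      swap : ∀ x a b c e → x xor ((a ∧ b) xor (c ∧ e)) ≡ x xor ((e ∧ c) xor (b ∧ a))
      swap = solve-∀ Z₂

  reduced-alternating : ∀ s → reduced s s ≡ false
  reduced-alternating s = begin
    reduced s s
      ≡⟨ cong₂ _xor_ (alternating (ι s)) (cong₂ _xor_ (cong (x ∧_) (symmetric _ _)) (cong (y ∧_) (symmetric _ _))) ⟩
    (x ∧ y) xor (y ∧ x)  ≡⟨ cong ((x ∧ y) xor_) (∧-comm y x) ⟩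
    (x ∧ y) xor (x ∧ y)  ≡⟨ xor-same (x ∧ y) ⟩
    false                ∎
    where
      x = G (ι s) zero
      y = G (ι s) (suc j)

  -- Σₛ c s · p(e_{ι s}) in the basis of G: α and β are its e₀- and eⱼ-coefficients.
  module Lift (c : Fin d → Bool) where
    α β : Bool
    α = sum (λ s → c s ∧ G (suc j) (ι s))
    β = sum (λ s → c s ∧ G zero (ι s))

    lift : Fin (suc (suc d)) → Bool
    lift = α ∷ insertAt c j β

    *ᵥ-lift : ∀ u → (G *ᵥ lift) u ≡ (α ∧ G u zero) xor ((β ∧ G u (suc j)) xor sum (λ s → c s ∧ G u (ι s)))
    *ᵥ-lift u = cong ((α ∧ G u zero) xor_) (sum-insertAt c j β (G u ∘ suc))

    reduced-*ᵥ : ∀ r → (reduced *ᵥ c) r ≡ (G *ᵥ lift) (ι r)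
    reduced-*ᵥ r = begin
      sum (λ s → c s ∧ reduced r s)
        ≡⟨ sum-cong-≗ {x = λ s → c s ∧ reduced r s}
             (λ s → distrib (c s) (G (ι r) (ι s)) x (G (suc j) (ι s)) y (G zero (ι s))) ⟩
      sum (λ s → (c s ∧ G (ι r) (ι s)) xor ((x ∧ (c s ∧ G (suc j) (ι s))) xor (y ∧ (c s ∧ G zero (ι s)))))
        ≡⟨ ∑-distrib-xor₃ (λ s → c s ∧ G (ι r) (ι s)) (λ s → x ∧ (c s ∧ G (suc j) (ι s)))
                          (λ s → y ∧ (c s ∧ G zero (ι s))) ⟩
      own xor (sum (λ s → x ∧ (c s ∧ G (suc j) (ι s))) xor sum (λ s → y ∧ (c s ∧ G zero (ι s))))
        ≡⟨ cong (own xor_) (sym (cong₂ _xor_ (*-distribˡ-sum x (λ s → c s ∧ G (suc j) (ι s)))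
                                             (*-distribˡ-sum y (λ s → c s ∧ G zero (ι s))))) ⟩
      own xor ((x ∧ α) xor (y ∧ β))
        ≡⟨ rearrange own x y α β ⟩
      (α ∧ x) xor ((β ∧ y) xor own)
        ≡⟨ *ᵥ-lift (ι r) ⟨
      (G *ᵥ lift) (ι r) ∎
      where
        x = G (ι r) zero
        y = G (ι r) (suc j)
        own = sum (λ s → c s ∧ G (ι r) (ι s))
        distrib : ∀ c g x a y b → c ∧ (g xor ((x ∧ a) xor (y ∧ b))) ≡ (c ∧ g) xor ((x ∧ (c ∧ a)) xor (y ∧ (c ∧ b)))
        distrib = solve-∀ Z₂
        rearrange : ∀ o x y α β → o xor ((x ∧ α) xor (y ∧ β)) ≡ (α ∧ x) xor ((β ∧ y) xor o)
        rearrange = solve-∀ Z₂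

    lift-in-kernel : (∀ r → (reduced *ᵥ c) r ≡ false) → ∀ u → (G *ᵥ lift) u ≡ false
    lift-in-kernel _ zero = begin
      (G *ᵥ lift) zero                  ≡⟨ *ᵥ-lift zero ⟩
      (α ∧ G zero zero) xor ((β ∧ G zero (suc j)) xor β)
        ≡⟨ cong₂ (λ a b → (α ∧ a) xor ((β ∧ b) xor β)) (alternating zero) G0j ⟩
      (α ∧ false) xor ((β ∧ true) xor β)
        ≡⟨ cong₂ (λ a b → a xor (b xor β)) (∧-zeroʳ α) (∧-identityʳ β) ⟩
      β xor β                           ≡⟨ xor-same β ⟩
      false ∎
    lift-in-kernel _ (suc u) with j ≟ u
    ... | yes refl = begin
      (G *ᵥ lift) (suc j)               ≡⟨ *ᵥ-lift (suc j) ⟩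
      (α ∧ G (suc j) zero) xor ((β ∧ G (suc j) (suc j)) xor α)
        ≡⟨ cong₂ (λ a b → (α ∧ a) xor ((β ∧ b) xor α)) (trans (symmetric _ _) G0j) (alternating (suc j)) ⟩
      (α ∧ true) xor ((β ∧ false) xor α)
        ≡⟨ cong₂ (λ a b → a xor (b xor α)) (∧-identityʳ α) (∧-zeroʳ β) ⟩
      α xor α                           ≡⟨ xor-same α ⟩
      false ∎
    lift-in-kernel hc (suc u) | no j≢u =
      subst (λ v → (G *ᵥ lift) (suc v) ≡ false) (punchIn-punchOut j≢u)
            (trans (sym (reduced-*ᵥ (punchOut j≢u))) (hc (punchOut j≢u)))

  reduced-nondegenerate : ∀ c → (∀ r → (reduced *ᵥ c) r ≡ false) → ∀ s → c s ≡ false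
  reduced-nondegenerate c hc s =
    trans (sym (insertAt-punchIn c j β s)) (nondegenerate lift (lift-in-kernel hc) (ι s))
    where open Lift c

  reduced-isSymplectic : IsSymplectic reduced
  reduced-isSymplectic = record
    { symmetric = reduced-symmetric ; alternating = reduced-alternating ; nondegenerate = reduced-nondegenerate }

symplectic⇒even : ∀ {d} {G : Matrix d} → IsSymplectic G → 2 ∣ d
symplectic⇒even {zero} _ = 2 ∣0
symplectic⇒even {suc zero} sp with hyperbolic-partner sp
... | () , _
symplectic⇒even {suc (suc d)} sp with hyperbolic-partner sp
... | j , G0j = ∣m∣n⇒∣m+n ∣-refl (symplectic⇒even (Reduction.reduced-isSymplectic sp j G0j))

-- Self-adjoint maps over Z₂

dot : ∀ {n} → State n → State n → Bool
dot u v = sum (λ i → u i ∧ v i)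

ones : ∀ {n} → State n
ones _ = true

dot-comm : ∀ {n} (u v : State n) → dot u v ≡ dot v u
dot-comm u v = sum-cong-≗ {x = λ i → u i ∧ v i} (λ i → ∧-comm (u i) (v i))

dot-cong : ∀ {n} {u u′ v v′ : State n} → (∀ i → u i ≡ u′ i) → (∀ i → v i ≡ v′ i) → dot u v ≡ dot u′ v′
dot-cong {u = u} {v = v} u≗u′ v≗v′ = sum-cong-≗ {x = λ i → u i ∧ v i} (λ i → cong₂ _∧_ (u≗u′ i) (v≗v′ i))

dot-self : ∀ {n} (w : State n) → dot w w ≡ dot ones w
dot-self w = sum-cong-≗ {x = λ i → w i ∧ w i} (λ i → ∧-idem (w i))

dot-zeroˡ : ∀ {n} {u v : State n} → (∀ i → u i ≡ false) → dot u v ≡ false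
dot-zeroˡ {u = u} {v} u≗0 = sum-vanishing (λ i → u i ∧ v i) (λ i → cong (_∧ v i) (u≗0 i))

dot-separates : ∀ {n} (v : State n) → (∀ w → dot w v ≡ false) → ∀ i → v i ≡ false
dot-separates {suc n} v v⊥ zero =
  trans (sym (trans (cong (v zero xor_) (sum-replicate-zero n)) (xor-identityʳ (v zero)))) (v⊥ (true ∷ const false))
dot-separates v v⊥ (suc i) = dot-separates (v ∘ suc) (λ w → v⊥ (false ∷ w)) i

linComb≡sum : ∀ {n d} (b : Fin d → State n) c i → linComb b c i ≡ sum (λ t → c t ∧ b t i)
linComb≡sum b c i = ⊕Σ≡sum (λ t → c t ∧ b t i)

linComb-cong : ∀ {n d} {b b′ : Fin d → State n} c → (∀ t i → b t i ≡ b′ t i) → ∀ i → linComb b c i ≡ linComb b′ c i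
linComb-cong {b = b} {b′} c b≗b′ i = trans (linComb≡sum b c i)
  (trans (sum-cong-≗ {x = λ t → c t ∧ b t i} (λ t → cong (c t ∧_) (b≗b′ t i))) (sym (linComb≡sum b′ c i)))

dot-linCombˡ : ∀ {n d} (z : Fin d → State n) c v → dot (linComb z c) v ≡ sum (λ t → c t ∧ dot (z t) v)
dot-linCombˡ z c v = begin
  sum (λ i → linComb z c i ∧ v i)                     ≡⟨ sum-cong-≗ {x = λ i → linComb z c i ∧ v i}
                                                          (λ i → cong (_∧ v i) (linComb≡sum z c i)) ⟩
  sum (λ i → sum (λ t → c t ∧ z t i) ∧ v i)           ≡⟨ sum-cong-≗ {x = λ i → sum (λ t → c t ∧ z t i) ∧ v i}
                                                          (λ i → *-distribʳ-sum (v i) (λ t → c t ∧ z t i)) ⟩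
  sum (λ i → sum (λ t → (c t ∧ z t i) ∧ v i))         ≡⟨ ∑-comm (λ i t → (c t ∧ z t i) ∧ v i) ⟩
  sum (λ t → sum (λ i → (c t ∧ z t i) ∧ v i))         ≡⟨ sum-cong-≗ {x = λ t → sum (λ i → (c t ∧ z t i) ∧ v i)}
                                                          (λ t → sum-cong-≗ {x = λ i → (c t ∧ z t i) ∧ v i}
                                                                   (λ i → ∧-assoc (c t) (z t i) (v i))) ⟩
  sum (λ t → sum (λ i → c t ∧ (z t i ∧ v i)))         ≡⟨ sum-cong-≗ {x = λ t → c t ∧ dot (z t) v}
                                                          (λ t → *-distribˡ-sum (c t) (λ i → z t i ∧ v i)) ⟨
  sum (λ t → c t ∧ dot (z t) v)                       ∎

record IsLinear {n} (f : State n → State n) : Set where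
  field
    cong-≗  : ∀ {u v} → (∀ i → u i ≡ v i) → ∀ i → f u i ≡ f v i
    linComb-commute : ∀ {d} (y : Fin d → State n) c i → f (linComb y c) i ≡ linComb (f ∘ y) c i

  -- zeroVec is the empty linear combination
  zero-preserving : ∀ i → f zeroVec i ≡ false
  zero-preserving = linComb-commute {d = 0} (λ ()) (λ ())

SelfAdjoint : ∀ {n} → (State n → State n) → Set
SelfAdjoint f = ∀ u v → dot u (f v) ≡ dot (f u) v

Alternating : ∀ {n} → (State n → State n) → Set
Alternating f = ∀ u → dot u (f u) ≡ false

-- The form ω(f u, f v) = ⟨u, f v⟩ on Im f, written in the basis b = f ∘ preimage.
module Gram {n} {f : State n → State n} (lin : IsLinear f) (adj : SelfAdjoint f) (alt : Alternating f)
            {d} {b : Fin d → State n} (basis : IsBasis (InImage f) b) where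
  open IsLinear lin
  open IsBasis basis

  preimage : Fin d → State n
  preimage t = proj₁ (inside t)

  gram : Matrix d
  gram s t = dot (preimage s) (f (preimage t))

  gram-symmetric : ∀ s t → gram s t ≡ gram t s
  gram-symmetric s t = trans (adj (preimage s) (preimage t)) (dot-comm (f (preimage s)) (preimage t))

  image-is-image-of-preimages : ∀ w → ∃ λ e → ∀ i → f w i ≡ f (linComb preimage e) i
  image-is-image-of-preimages w with spanning (f w) (w , λ _ → refl)
  ... | e , b[e]≗fw = e , λ i → begin
    f w i                       ≡⟨ b[e]≗fw i ⟨
    linComb b e i               ≡⟨ linComb-cong e (λ t → sym ∘ proj₂ (inside t)) i ⟩
    linComb (f ∘ preimage) e i  ≡⟨ linComb-commute preimage e i ⟨
    f (linComb preimage e) i    ∎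

  gram-nondegenerate : ∀ c → (∀ s → (gram *ᵥ c) s ≡ false) → ∀ t → c t ≡ false
  gram-nondegenerate c gc≡0 = independent c b[c]≡0
    where
      Y = linComb preimage c

      fY⊥preimage : ∀ s → dot (preimage s) (f Y) ≡ false
      fY⊥preimage s = begin
        dot (preimage s) (f Y)                       ≡⟨ dot-cong (λ _ → refl) (linComb-commute preimage c) ⟩
        dot (preimage s) (linComb (f ∘ preimage) c)  ≡⟨ dot-comm (preimage s) (linComb (f ∘ preimage) c) ⟩
        dot (linComb (f ∘ preimage) c) (preimage s)  ≡⟨ dot-linCombˡ (f ∘ preimage) c (preimage s) ⟩
        sum (λ t → c t ∧ dot (f (preimage t)) (preimage s))
          ≡⟨ sum-cong-≗ {x = λ t → c t ∧ dot (f (preimage t)) (preimage s)}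
               (λ t → cong (c t ∧_) (dot-comm (f (preimage t)) (preimage s))) ⟩
        (gram *ᵥ c) s                                ≡⟨ gc≡0 s ⟩
        false                                        ∎

      fY⊥ : ∀ w → dot w (f Y) ≡ false
      fY⊥ w with image-is-image-of-preimages w
      ... | e , fw≗fYₑ = begin
        dot w (f Y)                          ≡⟨ adj w Y ⟩
        dot (f w) Y                          ≡⟨ dot-cong fw≗fYₑ (λ _ → refl) ⟩
        dot (f (linComb preimage e)) Y       ≡⟨ adj (linComb preimage e) Y ⟨
        dot (linComb preimage e) (f Y)       ≡⟨ dot-linCombˡ preimage e (f Y) ⟩
        sum (λ t → e t ∧ dot (preimage t) (f Y))
          ≡⟨ sum-vanishing (λ t → e t ∧ dot (preimage t) (f Y))
               (λ t → trans (cong (e t ∧_) (fY⊥preimage t)) (∧-zeroʳ (e t))) ⟩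
        false                                ∎

      b[c]≡0 : ∀ i → linComb b c i ≡ false
      b[c]≡0 i = begin
        linComb b c i                ≡⟨ linComb-cong c (λ t → sym ∘ proj₂ (inside t)) i ⟩
        linComb (f ∘ preimage) c i   ≡⟨ linComb-commute preimage c i ⟨
        f Y i                        ≡⟨ dot-separates (f Y) fY⊥ i ⟩
        false                        ∎

  gram-isSymplectic : IsSymplectic gram
  gram-isSymplectic = record
    { symmetric = gram-symmetric ; alternating = alt ∘ preimage ; nondegenerate = gram-nondegenerate }

image-dim-even : ∀ {n} {f : State n → State n} → IsLinear f → SelfAdjoint f → Alternating f →
  ∀ {d} → HasDim (InImage f) d → 2 ∣ d
image-dim-even lin adj alt (_ , basis) = symplectic⇒even (Gram.gram-isSymplectic lin adj alt basis)

hasDim-image-cong : ∀ {n} {f g : State n → State n} → (∀ v i → f v i ≡ g v i) →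
  ∀ {d} → HasDim (InImage f) d → HasDim (InImage g) d
hasDim-image-cong f≗g (b , basis) = b , record
  { inside      = λ t → let (w , fw≗bt) = inside t in w , λ i → trans (sym (f≗g w i)) (fw≗bt i)
  ; independent = independent
  ; spanning    = λ v → λ (w , gw≗v) → spanning v (w , λ i → trans (f≗g w i) (gw≗v i))
  }
  where open IsBasis basis

iter-+ : ∀ {A : Set} p q (f : A → A) x → iter (p + q) f x ≡ iter p f (iter q f x)
iter-+ zero    q f x = refl
iter-+ (suc p) q f x = cong f (iter-+ p q f x)

iter-suc : ∀ {A : Set} p (f : A → A) x → iter p f (f x) ≡ f (iter p f x)
iter-suc zero    f x = refl
iter-suc (suc p) f x = cong f (iter-suc p f x)

iter-isLinear : ∀ {n} {f : State n → State n} → IsLinear f → ∀ p → IsLinear (iter p f)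
iter-isLinear lin zero    = record { cong-≗ = λ u≗v → u≗v ; linComb-commute = λ _ _ _ → refl }
iter-isLinear {f = f} lin (suc p) = record
  { cong-≗          = λ u≗v → cong-≗ (IsLinear.cong-≗ fᵖ u≗v)
  ; linComb-commute = λ y c → λ i →
      trans (cong-≗ (IsLinear.linComb-commute fᵖ y c) i) (linComb-commute (iter p f ∘ y) c i)
  }
  where
    open IsLinear lin
    fᵖ = iter-isLinear lin p

iter-selfAdjoint : ∀ {n} {f : State n → State n} → SelfAdjoint f → ∀ p → SelfAdjoint (iter p f)
iter-selfAdjoint adj zero    u v = refl
iter-selfAdjoint {f = f} adj (suc p) u v = begin
  dot u (f (iter p f v))   ≡⟨ adj u (iter p f v) ⟩
  dot (f u) (iter p f v)   ≡⟨ iter-selfAdjoint adj p (f u) v ⟩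
  dot (iter p f (f u)) v   ≡⟨ cong (λ w → dot w v) (iter-suc p f u) ⟩
  dot (f (iter p f u)) v   ∎

iter-annihilates : ∀ {n} {f : State n → State n} {v} → IsLinear f → (∀ i → f v i ≡ false) →
  ∀ p i → iter (suc p) f v i ≡ false
iter-annihilates lin fv≡0 zero    = fv≡0
iter-annihilates lin fv≡0 (suc p) i =
  trans (IsLinear.cong-≗ lin (iter-annihilates lin fv≡0 p) i) (IsLinear.zero-preserving lin i)

alternating-square : ∀ {n} {g : State n → State n} → SelfAdjoint g → (∀ i → g ones i ≡ false) →
  Alternating (g ∘ g)
alternating-square {g = g} adj g1≡0 u = begin
  dot u (g (g u))    ≡⟨ adj u (g u) ⟩
  dot (g u) (g u)    ≡⟨ dot-self (g u) ⟩
  dot ones (g u)     ≡⟨ adj ones u ⟩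
  dot (g ones) u     ≡⟨ dot-zeroˡ g1≡0 ⟩
  false              ∎

iter-shift : ∀ {n} {f : State n → State n} {x y} → IsLinear f → iter x f ≗ₗ iter y f →
  ∀ q → iter (q + x) f ≗ₗ iter (q + y) f
iter-shift {f = f} {x} {y} lin fˣ≗fʸ q v i = begin
  iter (q + x) f v i       ≡⟨ cong (λ w → w i) (iter-+ q x f v) ⟩
  iter q f (iter x f v) i  ≡⟨ IsLinear.cong-≗ (iter-isLinear lin q) (fˣ≗fʸ v) i ⟩
  iter q f (iter y f v) i  ≡⟨ cong (λ w → w i) (iter-+ q y f v) ⟨
  iter (q + y) f v i       ∎

iter-periodic : ∀ {n} {f : State n → State n} {k m} → IsLinear f → iter (k + m) f ≗ₗ iter k f →
  ∀ t → iter (t * m + k) f ≗ₗ iter k f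
iter-periodic lin period zero v i = refl
iter-periodic {f = f} {k} {m} lin period (suc t) v i = begin
  iter ((m + t * m) + k) f v i  ≡⟨ cong (λ e → iter e f v i) (rearrange m t k) ⟩
  iter (t * m + (k + m)) f v i  ≡⟨ iter-shift lin period (t * m) v i ⟩
  iter (t * m + k) f v i        ≡⟨ iter-periodic lin period t v i ⟩
  iter k f v i                  ∎
  where
    rearrange : ∀ m t k → (m + t * m) + k ≡ t * m + (k + m)
    rearrange = ℕ-Solver.solve-∀

-- The harmonic operator

odd : ℕ → Bool
odd s = s % 2 ≡ᵇ 1

odd-suc : ∀ s → odd (suc s) ≡ not (odd s)
odd-suc zero          = refl
odd-suc (suc zero)    = refl
odd-suc (suc (suc s)) = odd-suc s

foldr-xor≡odd-count : ∀ {A : Set} (f : A → Bool) xs →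
  foldr (λ x b → f x xor b) false xs ≡ odd (ℕ.sum (List.map (λ x → if f x then 1 else 0) xs))
foldr-xor≡odd-count f List.[] = refl
foldr-xor≡odd-count f (x List.∷ xs) with f x
... | true  = trans (cong not (foldr-xor≡odd-count f xs))
                    (sym (odd-suc (ℕ.sum (List.map (λ x → if f x then 1 else 0) xs))))
... | false = foldr-xor≡odd-count f xs

*ᵥ-selfAdjoint : ∀ {n} {A : Matrix n} → (∀ i j → A i j ≡ A j i) → SelfAdjoint (A *ᵥ_)
*ᵥ-selfAdjoint {A = A} A-sym u v = begin
  dot u (A *ᵥ v)                ≡⟨ dot-cong (λ _ → refl) Av≗linComb ⟩
  dot u (linComb A v)           ≡⟨ dot-comm u (linComb A v) ⟩
  dot (linComb A v) u           ≡⟨ dot-linCombˡ A v u ⟩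
  sum (λ j → v j ∧ dot (A j) u) ≡⟨ sum-cong-≗ {x = λ j → v j ∧ dot (A j) u} (λ j → cong (v j ∧_) (dot-comm (A j) u)) ⟩
  dot v (A *ᵥ u)                ≡⟨ dot-comm v (A *ᵥ u) ⟩
  dot (A *ᵥ u) v                ∎
  where
    Av≗linComb : ∀ i → (A *ᵥ v) i ≡ linComb A v i
    Av≗linComb i = trans (sum-cong-≗ {x = λ j → v j ∧ A i j} (λ j → cong (v j ∧_) (A-sym i j))) (sym (linComb≡sum A v i))

module _ {n} (G : SimpleGraph n) where
  private
    H = harmonicMatrix G

  harmonicMatrix-symmetric : ∀ i j → H i j ≡ H j i
  harmonicMatrix-symmetric i j with i ≟ j | j ≟ i
  ... | yes refl | yes _    = refl
  ... | yes refl | no j≢i   = contradiction refl j≢i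
  ... | no i≢j   | yes refl = contradiction refl i≢j
  ... | no _     | no _     = adj-sym G i j

  harmonicMatrix-offDiagonal : ∀ {i j} → i ≢ j → H i j ≡ adj G i j
  harmonicMatrix-offDiagonal {i} {j} i≢j with i ≟ j
  ... | yes i≡j = contradiction i≡j i≢j
  ... | no _    = refl

  harmonicMatrix-diagonal : ∀ i → H i i ≡ oddDeg G i
  harmonicMatrix-diagonal i with i ≟ i
  ... | yes _  = cong (_xor oddDeg G i) (loopless G i)
  ... | no i≢i = contradiction refl i≢i

  harmonic≡*ᵥ : ∀ v i → harmonic G v i ≡ (H *ᵥ v) i
  harmonic≡*ᵥ v i = trans (⊕Σ≡sum (λ j → H i j ∧ v j)) (sum-cong-≗ {x = λ j → H i j ∧ v j} (λ j → ∧-comm (H i j) (v j)))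

  harmonic-isLinear : IsLinear (harmonic G)
  harmonic-isLinear = record
    { cong-≗ = λ {u} {v} u≗v i → begin
        harmonic G u i   ≡⟨ harmonic≡*ᵥ u i ⟩
        dot u (H i)      ≡⟨ dot-cong u≗v (λ _ → refl) ⟩
        dot v (H i)      ≡⟨ harmonic≡*ᵥ v i ⟨
        harmonic G v i   ∎
    ; linComb-commute = λ y c i → begin
        harmonic G (linComb y c) i            ≡⟨ harmonic≡*ᵥ (linComb y c) i ⟩
        dot (linComb y c) (H i)               ≡⟨ dot-linCombˡ y c (H i) ⟩
        sum (λ t → c t ∧ dot (y t) (H i))     ≡⟨ sum-cong-≗ {x = λ t → c t ∧ harmonic G (y t) i}
                                                   (λ t → cong (c t ∧_) (harmonic≡*ᵥ (y t) i)) ⟨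
        sum (λ t → c t ∧ harmonic G (y t) i)  ≡⟨ linComb≡sum (harmonic G ∘ y) c i ⟨
        linComb (harmonic G ∘ y) c i          ∎
    }

  harmonic-selfAdjoint : SelfAdjoint (harmonic G)
  harmonic-selfAdjoint u v = begin
    dot u (harmonic G v)  ≡⟨ dot-cong (λ _ → refl) (harmonic≡*ᵥ v) ⟩
    dot u (H *ᵥ v)        ≡⟨ *ᵥ-selfAdjoint harmonicMatrix-symmetric u v ⟩
    dot (H *ᵥ u) v        ≡⟨ dot-cong (harmonic≡*ᵥ u) (λ _ → refl) ⟨
    dot (harmonic G u) v  ∎

  -- Each row of A + D has an even number of ones: the degree plus its own parity.
  harmonic-ones : ∀ i → harmonic G ones i ≡ false
  harmonic-ones i = begin
    harmonic G ones i              ≡⟨ harmonic≡*ᵥ ones i ⟩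
    sum (H i)                      ≡⟨ cong (_xor sum (H i)) (loopless G i) ⟨
    adj G i i xor sum (H i)        ≡⟨ sum-update-at i (λ j i≢j → sym (harmonicMatrix-offDiagonal i≢j)) ⟩
    H i i xor sum (adj G i)        ≡⟨ cong (H i i xor_) (⊕Σ≡sum (adj G i)) ⟨
    H i i xor ⊕Σ (adj G i)         ≡⟨ cong₂ _xor_ (harmonicMatrix-diagonal i) (foldr-xor≡odd-count (adj G i) (allFin n)) ⟩
    oddDeg G i xor oddDeg G i      ≡⟨ xor-same (oddDeg G i) ⟩
    false                          ∎

  harmonic-even-power-alternating : ∀ p → Alternating (iter (suc p + suc p) (harmonic G))
  harmonic-even-power-alternating p u =
    trans (cong (dot u) (iter-+ (suc p) (suc p) (harmonic G) u))
          (alternating-square (iter-selfAdjoint harmonic-selfAdjoint (suc p))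
                              (iter-annihilates harmonic-isLinear harmonic-ones p) u)

corollary1 : ∀ {n} (G : SimpleGraph n) (k m : ℕ) → 1 ≤ m
    → iter (k + m) (harmonic G) ≗ₗ iter k (harmonic G)
    → (∀ k′ m′ → 1 ≤ m′ → iter (k′ + m′) (harmonic G) ≗ₗ iter k′ (harmonic G) → k ≤ k′ × m ≤ m′)
    → ∀ d → HasDim (InImage (iter (m * k) (harmonic G))) d → 2 ∣ d
corollary1 G k (suc m′) _ period _ d dim =
  image-dim-even (iter-isLinear lin (N + N)) (iter-selfAdjoint (harmonic-selfAdjoint G) (N + N))
                 (harmonic-even-power-alternating G (k + m′ * suc k)) (hasDim-image-cong aᵐᵏ≗a²ᴺ dim)
  where
    a = harmonic G
    lin = harmonic-isLinear G
    N = suc m′ * suc k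

    aᵐᵏ≗a²ᴺ : iter (suc m′ * k) a ≗ₗ iter (N + N) a
    aᵐᵏ≗a²ᴺ v i = begin
      iter (suc m′ * k) a v i                          ≡⟨ cong (λ e → iter e a v i) (e₁ m′ k) ⟩
      iter (m′ * k + k) a v i                          ≡⟨ iter-shift lin (iter-periodic lin period (k + 2)) (m′ * k) v i ⟨
      iter (m′ * k + ((k + 2) * suc m′ + k)) a v i     ≡⟨ cong (λ e → iter e a v i) (e₂ m′ k) ⟩
      iter (N + N) a v i                               ∎
      where
        e₁ : ∀ m′ k → suc m′ * k ≡ m′ * k + k
        e₁ = ℕ-Solver.solve-∀
        e₂ : ∀ m′ k → m′ * k + ((k + 2) * suc m′ + k) ≡ suc m′ * suc k + suc m′ * suc k
        e₂ = ℕ-Solver.solve-∀
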